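{- Let $G_1$ and $G_2$ be nontrivial finite groups that admit a DRR (respectively, a GRR), and suppose $\gcd(|G_1|,|G_2|)=1$. Then $G_1 \times G_2$ is not DRR-detecting (respectively, not GRR-detecting).
   Context: All groups and graphs are finite. For a subset $S$ of a group $G$, the Cayley digraph $\mathrm{Cay}(G,S)$ has vertex set $G$ and a directed edge from $g_1$ to $g_2$ iff $g_2 = s g_1$ for some $s \in S$; if $S$ is inverse-closed it is a graph (Cayley graph). $\mathrm{Aut}(G,S) = \{\varphi \in \mathrm{Aut}(G) : \varphi(S) = S\}$. A digraph $\Gamma$ is a DRR of $G$ if $\mathrm{Aut}(\Gamma) \cong G$ and acts regularly on the vertices; a GRR is a DRR that is a graph. $G$ admits a DRR (GRR) if some DRR (GRR) of $G$ exists. $G$ is GRR-detecting if for every inverse-closed $S \subseteq G$, $\mathrm{Aut}(G,S)=\{1\}$ implies $\mathrm{Cay}(G,S)$ is a GRR; $G$ is DRR-detecting if for every $S \subseteq G$, $\mathrm{Aut}(G,S)=\{1\}$ implies $\mathrm{Cay}(G,S)$ is a DRR. -}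

module Defs where

open import Data.Nat using (ℕ; _*_)
open import Data.Fin using (Fin)
open import Data.Fin.Properties using (*↔×)
open import Data.Bool using (Bool; true)
open import Data.Product using (Σ; ∃; _×_; _,_; proj₁; proj₂)
open import Data.Product.Function.NonDependent.Propositional using (_×-↔_)
open import Function.Bundles using (_↔_; Inverse)
open import Function.Properties.Inverse using (↔-trans; ↔-sym)
open import Relation.Binary.PropositionalEquality using (_≡_; refl; cong₂)
open import Relation.Nullary using (¬_)

record FinGroup : Set₁ where
  infixl 7 _∙_
  field
    Carrier  : Set
    _∙_      : Carrier → Carrier → Carrier
    ε        : Carrier
    _⁻¹      : Carrier → Carrier
    assoc    : ∀ x y z → (x ∙ y) ∙ z ≡ x ∙ (y ∙ z)
    identityˡ : ∀ x → ε ∙ x ≡ x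
    identityʳ : ∀ x → x ∙ ε ≡ x
    inverseˡ : ∀ x → (x ⁻¹) ∙ x ≡ ε
    inverseʳ : ∀ x → x ∙ (x ⁻¹) ≡ ε
    order    : ℕ
    enum     : Carrier ↔ Fin order

open FinGroup

∣_∣ : FinGroup → ℕ
∣ G ∣ = order G

Nontrivial : FinGroup → Set
Nontrivial G = Σ (Carrier G) λ g → ¬ (g ≡ ε G)

_×G_ : FinGroup → FinGroup → FinGroup
G₁ ×G G₂ = record
  { Carrier   = Carrier G₁ × Carrier G₂
  ; _∙_       = λ x y → (_∙_ G₁ (proj₁ x) (proj₁ y) , _∙_ G₂ (proj₂ x) (proj₂ y))
  ; ε         = (ε G₁ , ε G₂)
  ; _⁻¹       = λ x → (_⁻¹ G₁ (proj₁ x) , _⁻¹ G₂ (proj₂ x))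
  ; assoc     = λ x y z → cong₂ _,_ (assoc G₁ _ _ _) (assoc G₂ _ _ _)
  ; identityˡ = λ x → cong₂ _,_ (identityˡ G₁ _) (identityˡ G₂ _)
  ; identityʳ = λ x → cong₂ _,_ (identityʳ G₁ _) (identityʳ G₂ _)
  ; inverseˡ  = λ x → cong₂ _,_ (inverseˡ G₁ _) (inverseˡ G₂ _)
  ; inverseʳ  = λ x → cong₂ _,_ (inverseʳ G₁ _) (inverseʳ G₂ _)
  ; order     = order G₁ * order G₂
  ; enum      = ↔-trans (enum G₁ ×-↔ enum G₂) (↔-sym *↔×)
  }

Subset : FinGroup → Set
Subset G = Carrier G → Bool

_∈_ : ∀ {G} → Carrier G → Subset G → Set
x ∈ S = S x ≡ true

InverseClosed : (G : FinGroup) → Subset G → Set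
InverseClosed G S = ∀ s → _∈_ {G} s S → _∈_ {G} (_⁻¹ G s) S

record Digraph (V : Set) : Set₁ where
  field
    Edge : V → V → Set

open Digraph

record DigraphAut {V : Set} (Γ : Digraph V) : Set where
  field
    perm     : V ↔ V
    preserve : ∀ x y → Edge Γ x y → Edge Γ (Inverse.to perm x) (Inverse.to perm y)
    reflect  : ∀ x y → Edge Γ (Inverse.to perm x) (Inverse.to perm y) → Edge Γ x y

open DigraphAut

apply : ∀ {V} {Γ : Digraph V} → DigraphAut Γ → V → V
apply f = Inverse.to (perm f)

AutRegular : ∀ {V} → Digraph V → Set
AutRegular {V} Γ =
  (∀ x y → Σ (DigraphAut Γ) λ f → apply f x ≡ y) ×
  (∀ (f g : DigraphAut Γ) x → apply f x ≡ apply g x → ∀ z → apply f z ≡ apply g z)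

Cay : (G : FinGroup) → Subset G → Digraph (Carrier G)
Cay G S = record { Edge = λ g₁ g₂ → Σ (Carrier G) λ s → _∈_ {G} s S × (g₂ ≡ _∙_ G s g₁) }

-- Cay(G,S) is a DRR of G (for a Cayley digraph, regularity of
-- Aut is equivalent to Aut(Γ) = G_R ≅ G acting regularly)
IsDRR : (G : FinGroup) → Subset G → Set
IsDRR G S = AutRegular (Cay G S)

record GroupAut (G : FinGroup) : Set where
  field
    bij   : Carrier G ↔ Carrier G
    homo  : ∀ x y → Inverse.to bij (_∙_ G x y) ≡ _∙_ G (Inverse.to bij x) (Inverse.to bij y)

-- φ(S) = S  (φ bijective, so this is: x ∈ S ⇔ φ(x) ∈ S)
Fixes : ∀ {G} → GroupAut G → Subset G → Set
Fixes φ S = ∀ x → S (Inverse.to (GroupAut.bij φ) x) ≡ S x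

AutGS-trivial : (G : FinGroup) → Subset G → Set
AutGS-trivial G S = ∀ (φ : GroupAut G) → Fixes φ S → ∀ x → Inverse.to (GroupAut.bij φ) x ≡ x

AdmitsDRR : FinGroup → Set
AdmitsDRR G = Σ (Subset G) λ S → IsDRR G S

-- a GRR is a DRR that is a graph, i.e. Cay(G,S) with S inverse-closed
AdmitsGRR : FinGroup → Set
AdmitsGRR G = Σ (Subset G) λ S → InverseClosed G S × IsDRR G S

DRR-detecting : FinGroup → Set
DRR-detecting G = ∀ (S : Subset G) → AutGS-trivial G S → IsDRR G S

GRR-detecting : FinGroup → Set
GRR-detecting G = ∀ (S : Subset G) → InverseClosed G S → AutGS-trivial G S → IsDRR G S

-- Let Cay(G₁, S₁) and Cay(G₂, S₂) be DRRs (GRRs) and S = ((S₁ ∖ {1}) × G₂) ∪ ({1} × S₂).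
-- Since |G₁| and |G₂| are coprime, every homomorphism between G₁ and G₂ is trivial (the image
-- y of x has y^|G₁| = y^|G₂| = 1 by Lagrange), so every automorphism of G₁ × G₂ is some α × δ.
-- If α × δ fixes S, then α fixes S₁ and δ fixes S₂; they are then automorphisms of the DRRs
-- fixing 1, hence trivial, and Aut(G₁ × G₂, S) = 1. Yet Cay(G₁ × G₂, S) is not a DRR:
-- multiplying the fibre {1} × G₂ on the right by some h ≠ 1 and fixing all other vertices is
-- a digraph automorphism with fixed points that is not the identity.

{-# OPTIONS --safe #-}
module Submission where

open import Defs
open import Algebra.Bundles using (Group)
import Algebra.Properties.Group as GroupProperties
import Algebra.Properties.Monoid.Mult as MonoidMult
open import Data.Bool.Base using (true; if_then_else_)
open import Data.Fin.Base using (Fin; zero; suc; toℕ)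
open import Data.Fin.Properties
  using (0≢1+n; any?; inj⇒≟; pigeonhole; suc-injective; toℕ<n; toℕ-injective) renaming (_≟_ to _≟ᶠ_)
open import Data.Nat.Base using (ℕ; zero; suc; _+_; _*_; _<_; s≤s; z<s)
open import Data.Nat.Coprimality using (gcd≡1⇒coprime; coprime-Bézout)
open import Data.Nat.Divisibility using (_∣_; divides; _∣0; ∣-refl; ∣m∣n⇒∣m+n)
open import Data.Nat.DivMod using (_divMod_; result)
open import Data.Nat.GCD using (gcd; gcd-comm; module Bézout)
open import Data.Nat.Induction using (<-rec)
open import Data.Nat.Properties using (+-suc; m≤n+m; m≤n⇒∃[o]m+o≡n; n<1+n; <-cmp; ≤-trans; m<n+m)
open import Data.Product.Base using (∃; _×_; _,_; proj₁; proj₂; map)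
open import Function.Base using (_∘_; id)
open import Function.Bundles using (_↔_; _⇔_; Equivalence; Inverse; Injection; mk↔ₛ′; mk⇔)
open import Function.Definitions using (Injective)
open import Function.Properties.Inverse using (↔⇒↣; ↔-refl)
open import Level using (Level; 0ℓ)
open import Relation.Binary.Definitions using (DecidableEquality; tri<; tri≈; tri>)
open import Relation.Binary.PropositionalEquality
  using (_≡_; _≢_; refl; sym; trans; cong; cong₂; subst; isEquivalence; module ≡-Reasoning)
open import Relation.Nullary.Decidable using (yes; no; does; does-⇔; dec-true; dec-false)
open import Relation.Nullary.Negation using (¬_; contradiction)
open import Relation.Unary using (Pred; Decidable; _∩_; ∁)
open import Relation.Unary.Properties using (U?; _∩?_; ∁?)

private variable
  n : ℕ
  p q : Level

∃-least : {P : Pred ℕ p} → Decidable P → P n → ∃ λ k → P k × (∀ {j} → j < k → ¬ P j)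
∃-least {n = zero}  P? P0 = 0 , P0 , λ ()
∃-least {n = suc n} {P = P} P? Pn with P? 0
... | yes P0 = 0 , P0 , λ ()
... | no ¬P0 with ∃-least (P? ∘ suc) Pn
...   | k , Pk , below = suc k , Pk , below′
  where
  below′ : ∀ {j} → j < suc k → ¬ P j
  below′ {zero}  _         = ¬P0
  below′ {suc j} (s≤s j<k) = below j<k

count : {P : Pred (Fin n) p} → Decidable P → ℕ
count {zero}  P? = 0
count {suc n} P? = if does (P? zero) then suc (count (P? ∘ suc)) else count (P? ∘ suc)

count-cong : {P : Pred (Fin n) p} {Q : Pred (Fin n) q} (P? : Decidable P) (Q? : Decidable Q) →
             (∀ i → P i ⇔ Q i) → count P? ≡ count Q?
count-cong {zero}  P? Q? P⇔Q = refl
count-cong {suc n} P? Q? P⇔Q =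
  cong₂ (λ b c → if b then suc c else c) (does-⇔ (P⇔Q zero) (P? zero) (Q? zero))
        (count-cong (P? ∘ suc) (Q? ∘ suc) (P⇔Q ∘ suc))

count-partition : {P : Pred (Fin n) p} {Q : Pred (Fin n) q} (P? : Decidable P) (Q? : Decidable Q) →
                  count P? ≡ count (P? ∩? Q?) + count (P? ∩? ∁? Q?)
count-partition {zero}  P? Q? = refl
count-partition {suc n} P? Q? with P? zero | Q? zero
... | yes _ | yes _ = cong suc (count-partition (P? ∘ suc) (Q? ∘ suc))
... | yes _ | no  _ = trans (cong suc (count-partition (P? ∘ suc) (Q? ∘ suc))) (sym (+-suc _ _))
... | no  _ | _     = count-partition (P? ∘ suc) (Q? ∘ suc)

count-none : {P : Pred (Fin n) p} (P? : Decidable P) → (∀ i → ¬ P i) → count P? ≡ 0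
count-none {zero}  P? ¬P = refl
count-none {suc n} P? ¬P with P? zero
... | yes P0 = contradiction P0 (¬P zero)
... | no  _  = count-none (P? ∘ suc) (¬P ∘ suc)

count-U : count (U? {A = Fin n}) ≡ n
count-U {zero}  = refl
count-U {suc n} = cong suc count-U

count-singleton : (j : Fin n) → count (_≟ᶠ j) ≡ 1
count-singleton {suc n} zero    = cong suc (count-none {n} (λ i → suc i ≟ᶠ zero) λ _ ())
count-singleton {suc n} (suc j) =
  trans (count-cong (λ i → suc i ≟ᶠ suc j) (_≟ᶠ j) λ _ → mk⇔ suc-injective (cong suc))
        (count-singleton j)

count>0⇒∃ : {P : Pred (Fin n) p} (P? : Decidable P) → 0 < count P? → ∃ P
count>0⇒∃ {suc n} P? pos with P? zero
... | yes P0 = zero , P0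
... | no  _  = map suc id (count>0⇒∃ (P? ∘ suc) pos)

module Enumerated {A : Set} (enum : A ↔ Fin n) where
  open Inverse enum using (to; from; strictlyInverseˡ; strictlyInverseʳ)

  infix 4 _≟_
  _≟_ : DecidableEquality A
  _≟_ = inj⇒≟ (↔⇒↣ enum)

  # : {P : Pred A p} → Decidable P → ℕ
  # P? = count (P? ∘ from)

  #-cong : {P : Pred A p} {Q : Pred A q} (P? : Decidable P) (Q? : Decidable Q) →
           (∀ a → P a ⇔ Q a) → # P? ≡ # Q?
  #-cong P? Q? P⇔Q = count-cong (P? ∘ from) (Q? ∘ from) (P⇔Q ∘ from)

  #-partition : {P : Pred A p} {Q : Pred A q} (P? : Decidable P) (Q? : Decidable Q) →
                # P? ≡ # (P? ∩? Q?) + # (P? ∩? ∁? Q?)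
  #-partition P? Q? = count-partition (P? ∘ from) (Q? ∘ from)

  #-singleton : (a : A) → # (_≟ a) ≡ 1
  #-singleton a = trans (count-cong ((_≟ a) ∘ from) (_≟ᶠ to a) from≡⇔) (count-singleton (to a))
    where
    from≡⇔ : ∀ i → from i ≡ a ⇔ i ≡ to a
    from≡⇔ i = mk⇔ (λ e → trans (sym (strictlyInverseˡ i)) (cong to e))
                   (λ e → trans (cong from e) (strictlyInverseʳ a))

  Image : ∀ {k} → (Fin k → A) → Pred A 0ℓ
  Image f a = ∃ λ i → a ≡ f i

  image? : ∀ {k} (f : Fin k → A) → Decidable (Image f)
  image? f a = any? λ i → a ≟ f i

  #-image : ∀ {k} (f : Fin k → A) → Injective _≡_ _≡_ f → # (image? f) ≡ k
  #-image {zero}  f f-inj = count-none (image? f ∘ from) λ { _ (() , _) }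
  #-image {suc k} f f-inj = begin
    # (image? f)                                  ≡⟨ #-partition (image? f) f₀? ⟩
    # (image? f ∩? f₀?) + # (image? f ∩? ∁? f₀?)  ≡⟨ cong₂ _+_ #[image∩f₀] #[image∖f₀] ⟩
    1 + k                                         ∎
    where
    open ≡-Reasoning
    f₀? : Decidable (_≡ f zero)
    f₀? = _≟ f zero
    #[image∩f₀] : # (image? f ∩? f₀?) ≡ 1
    #[image∩f₀] = trans (#-cong (image? f ∩? f₀?) f₀? λ _ → mk⇔ proj₂ λ e → (zero , e) , e)
                        (#-singleton (f zero))
    off-zero : ∀ {a} → (Image f a × a ≢ f zero) ⇔ Image (f ∘ suc) a
    off-zero = mk⇔ (λ where ((zero , e) , a≢f₀) → contradiction e a≢f₀
                            ((suc i , e) , _)   → i , e)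
                   (λ where (i , refl) → (suc i , refl) , 0≢1+n ∘ sym ∘ f-inj)
    #[image∖f₀] : # (image? f ∩? ∁? f₀?) ≡ k
    #[image∖f₀] = trans (#-cong (image? f ∩? ∁? f₀?) (image? (f ∘ suc)) λ _ → off-zero)
                        (#-image (f ∘ suc) (suc-injective ∘ f-inj))

group : FinGroup → Group 0ℓ 0ℓ
group G = record
  { Carrier = Carrier
  ; _≈_     = _≡_
  ; _∙_     = _∙_
  ; ε       = ε
  ; _⁻¹     = _⁻¹
  ; isGroup = record
    { isMonoid = record
      { isSemigroup = record
        { isMagma = record { isEquivalence = isEquivalence ; ∙-cong = cong₂ _∙_ }
        ; assoc   = assoc
        }
      ; identity = identityˡ , identityʳ
      }
    ; inverse = inverseˡ , inverseʳ
    ; ⁻¹-cong = cong _⁻¹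
    }
  }
  where open FinGroup G

module FinGroupProperties (G : FinGroup) where
  open FinGroup G
  open Group (group G) public using (_//_)
  open GroupProperties (group G) public
    using (∙-cancelˡ; ∙-cancelʳ; identityˡ-unique; inverseʳ-unique; ε⁻¹≈ε; ⁻¹-involutive;
           ⁻¹-anti-homo-∙; x∙y⁻¹≈ε⇒x≈y; \\-leftDividesʳ; //-rightDividesˡ; //-rightDividesʳ)
  open MonoidMult (Group.monoid (group G)) using (×-homo-+; ×-assocˡ) renaming (_×_ to _times_)
  open Enumerated enum public using (_≟_; #; #-cong; #-partition; #-image; Image; image?)

  infixr 8 _^_
  _^_ : Carrier → ℕ → Carrier
  x ^ m = m times x

  ^-+ : ∀ x m n → x ^ (m + n) ≡ x ^ m ∙ x ^ n
  ^-+ x = ×-homo-+ x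

  ε^ : ∀ m → ε ^ m ≡ ε
  ε^ zero    = refl
  ε^ (suc m) = trans (identityˡ _) (ε^ m)

  ^-*-ε : ∀ {x k} q → x ^ k ≡ ε → x ^ (q * k) ≡ ε
  ^-*-ε {x} {k} q x^k≡ε = trans (sym (×-assocˡ x q k)) (trans (cong (q times_) x^k≡ε) (ε^ q))

  ^-Bézout-ε : ∀ y a b u v → 1 + v * b ≡ u * a → y ^ a ≡ ε → y ^ b ≡ ε → y ≡ ε
  ^-Bézout-ε y a b u v 1+vb≡ua y^a≡ε y^b≡ε = begin
    y                  ≡⟨ identityʳ y ⟨
    y ∙ ε              ≡⟨ cong (y ∙_) (^-*-ε v y^b≡ε) ⟨
    y ^ (1 + v * b)    ≡⟨ cong (y ^_) 1+vb≡ua ⟩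
    y ^ (u * a)        ≡⟨ ^-*-ε u y^a≡ε ⟩
    ε                  ∎
    where open ≡-Reasoning

  ^-coprime-ε : ∀ {a b} y → gcd a b ≡ 1 → y ^ a ≡ ε → y ^ b ≡ ε → y ≡ ε
  ^-coprime-ε {a} {b} y gcd≡1 y^a≡ε y^b≡ε with coprime-Bézout (gcd≡1⇒coprime {a} {b} gcd≡1)
  ... | Bézout.+- u v 1+vb≡ua = ^-Bézout-ε y a b u v 1+vb≡ua y^a≡ε y^b≡ε
  ... | Bézout.-+ u v 1+ua≡vb = ^-Bézout-ε y b a v u 1+ua≡vb y^b≡ε y^a≡ε

  ^-period : ∀ x i d → x ^ i ≡ x ^ (suc i + d) → x ^ suc d ≡ ε
  ^-period x i d x^i≡x^[1+i+d] = ∙-cancelˡ (x ^ i) _ _ (begin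
    x ^ i ∙ x ^ suc d   ≡⟨ ^-+ x i (suc d) ⟨
    x ^ (i + suc d)     ≡⟨ cong (x ^_) (+-suc i d) ⟩
    x ^ (suc i + d)     ≡⟨ x^i≡x^[1+i+d] ⟨
    x ^ i               ≡⟨ identityʳ _ ⟨
    x ^ i ∙ ε           ∎)
    where open ≡-Reasoning

  x∙z//y∙z≡x//y : ∀ x y z → (x ∙ z) // (y ∙ z) ≡ x // y
  x∙z//y∙z≡x//y x y z = begin
    (x ∙ z) ∙ (y ∙ z) ⁻¹       ≡⟨ cong ((x ∙ z) ∙_) (⁻¹-anti-homo-∙ y z) ⟩
    (x ∙ z) ∙ (z ⁻¹ ∙ y ⁻¹)    ≡⟨ sym (assoc _ _ _) ⟩
    ((x ∙ z) ∙ z ⁻¹) ∙ y ⁻¹    ≡⟨ cong (_∙ y ⁻¹) (//-rightDividesʳ z x) ⟩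
    x ∙ y ⁻¹                   ∎
    where open ≡-Reasoning

module Lagrange (G : FinGroup) where
  open FinGroup G
  open FinGroupProperties G
  open Inverse enum using (to; from)

  ∃-period : ∀ x → ∃ λ d → x ^ suc d ≡ ε
  ∃-period x with pigeonhole (n<1+n order) (λ i → to (x ^ toℕ i))
  ... | i , j , i<j , to-x^i≡to-x^j with m≤n⇒∃[o]m+o≡n i<j
  ...   | d , 1+i+d≡j = d , ^-period x (toℕ i) d x^i≡x^[1+i+d]
    where
    x^i≡x^[1+i+d] : x ^ toℕ i ≡ x ^ (suc (toℕ i) + d)
    x^i≡x^[1+i+d] = trans (Injection.injective (↔⇒↣ enum) to-x^i≡to-x^j) (cong (x ^_) (sym 1+i+d≡j))

  module Period (x : Carrier) (k₀ : ℕ) (x^k≡ε : x ^ suc k₀ ≡ ε)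
                (minimal : ∀ {j} → j < k₀ → x ^ suc j ≢ ε) where
    k : ℕ
    k = suc k₀

    powers-distinct : ∀ {i j} → i < j → j < k → x ^ i ≢ x ^ j
    powers-distinct {i} i<j (s≤s j≤k₀) x^i≡x^j with m≤n⇒∃[o]m+o≡n i<j
    ... | d , refl = minimal (≤-trans (s≤s (m≤n+m d i)) j≤k₀) (^-period x i d x^i≡x^j)

    orbit : Carrier → Fin k → Carrier
    orbit y i = x ^ toℕ i ∙ y

    orbit-injective : ∀ y → Injective _≡_ _≡_ (orbit y)
    orbit-injective y {i} {j} e with <-cmp (toℕ i) (toℕ j)
    ... | tri< i<j _ _ = contradiction (∙-cancelʳ y _ _ e) (powers-distinct i<j (toℕ<n j))
    ... | tri≈ _ i≡j _ = toℕ-injective i≡j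
    ... | tri> _ _ j<i = contradiction (sym (∙-cancelʳ y _ _ e)) (powers-distinct j<i (toℕ<n i))

    orbit-∋ : ∀ y m → Image (orbit y) (x ^ m ∙ y)
    orbit-∋ y m with m divMod k
    ... | result q r m≡r+q*k = r , cong (_∙ y) (begin
      x ^ m                   ≡⟨ cong (x ^_) m≡r+q*k ⟩
      x ^ (toℕ r + q * k)     ≡⟨ ^-+ x (toℕ r) (q * k) ⟩
      x ^ toℕ r ∙ x ^ (q * k) ≡⟨ cong (x ^ toℕ r ∙_) (^-*-ε q x^k≡ε) ⟩
      x ^ toℕ r ∙ ε           ≡⟨ identityʳ _ ⟩
      x ^ toℕ r               ∎)
      where open ≡-Reasoning

    x⁻¹≡x^k₀ : x ⁻¹ ≡ x ^ k₀
    x⁻¹≡x^k₀ = sym (inverseʳ-unique x (x ^ k₀) x^k≡ε)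

    Invariant : Pred Carrier 0ℓ → Set
    Invariant R = ∀ z → R z ⇔ R (x ∙ z)

    orbit-invariant : ∀ y → Invariant (Image (orbit y))
    orbit-invariant y z = mk⇔
      (λ where (i , refl) → subst (Image (orbit y)) (assoc x (x ^ toℕ i) y) (orbit-∋ y (suc (toℕ i))))
      (λ where (i , xz≡x^i∙y) → subst (Image (orbit y)) (sym (z≡ (toℕ i) xz≡x^i∙y))
                                                         (orbit-∋ y (k₀ + toℕ i)))
      where
      open ≡-Reasoning
      z≡ : ∀ i → x ∙ z ≡ x ^ i ∙ y → z ≡ x ^ (k₀ + i) ∙ y
      z≡ i xz≡x^i∙y = begin
        z                      ≡⟨ sym (\\-leftDividesʳ x z) ⟩
        x ⁻¹ ∙ (x ∙ z)         ≡⟨ cong₂ _∙_ x⁻¹≡x^k₀ xz≡x^i∙y ⟩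
        x ^ k₀ ∙ (x ^ i ∙ y)   ≡⟨ sym (assoc _ _ _) ⟩
        x ^ k₀ ∙ x ^ i ∙ y     ≡⟨ cong (_∙ y) (sym (^-+ x k₀ i)) ⟩
        x ^ (k₀ + i) ∙ y       ∎

    invariant-⊇-orbit : ∀ {R y} → Invariant R → R y → ∀ {z} → Image (orbit y) z → R z
    invariant-⊇-orbit {R} {y} R-inv Ry (i , refl) = R-x^m∙y (toℕ i)
      where
      R-x^m∙y : ∀ m → R (x ^ m ∙ y)
      R-x^m∙y zero    = subst R (sym (identityˡ y)) Ry
      R-x^m∙y (suc m) = subst R (sym (assoc x (x ^ m) y)) (Equivalence.to (R-inv _) (R-x^m∙y m))

    without-orbit-invariant : ∀ {R} y → Invariant R → Invariant (R ∩ ∁ (Image (orbit y)))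
    without-orbit-invariant y R-inv z = mk⇔
      (λ (Rz , z∉O) → Equivalence.to (R-inv z) Rz , z∉O ∘ Equivalence.from (orbit-invariant y z))
      (λ (Rxz , xz∉O) → Equivalence.from (R-inv z) Rxz , xz∉O ∘ Equivalence.to (orbit-invariant y z))

    #-without-orbit : ∀ {R} (R? : Decidable R) → Invariant R → ∀ {y} → R y →
                      # R? ≡ k + # (R? ∩? ∁? (image? (orbit y)))
    #-without-orbit {R} R? R-inv {y} Ry = begin
      # R?                     ≡⟨ #-partition R? O? ⟩
      # (R? ∩? O?) + # R′?     ≡⟨ cong (_+ # R′?) (#-cong (R? ∩? O?) O? λ _ → R∩O⇔O) ⟩
      # O? + # R′?             ≡⟨ cong (_+ # R′?) (#-image (orbit y) (orbit-injective y)) ⟩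
      k + # R′?                ∎
      where
      open ≡-Reasoning
      O? : Decidable (Image (orbit y))
      O? = image? (orbit y)
      R′? : Decidable (R ∩ ∁ (Image (orbit y)))
      R′? = R? ∩? ∁? O?
      R∩O⇔O : ∀ {z} → (R z × Image (orbit y) z) ⇔ Image (orbit y) z
      R∩O⇔O = mk⇔ proj₂ λ z∈O → invariant-⊇-orbit R-inv Ry z∈O , z∈O

    -- An invariant R is a disjoint union of orbits, each of size k.
    period-∣-# : ∀ {R} (R? : Decidable R) → Invariant R → k ∣ # R?
    period-∣-# R? R-inv = <-rec Motive step (# R?) R? R-inv refl
      where
      Motive : ℕ → Set₁
      Motive m = ∀ {R} (R? : Decidable R) → Invariant R → # R? ≡ m → k ∣ m
      step : ∀ m → (∀ {m′} → m′ < m → Motive m′) → Motive m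
      step zero    _  _  _     _      = k ∣0
      step (suc m) ih R? R-inv #R≡1+m with count>0⇒∃ (R? ∘ from) (subst (0 <_) (sym #R≡1+m) z<s)
      ... | i , Ry = subst (k ∣_) #R≡k+#R′ (∣m∣n⇒∣m+n ∣-refl (ih #R′<#R R′? R′-inv refl))
        where
        R′? : Decidable (_ ∩ ∁ (Image (orbit (from i))))
        R′? = R? ∩? ∁? (image? (orbit (from i)))
        R′-inv : Invariant (_ ∩ ∁ (Image (orbit (from i))))
        R′-inv = without-orbit-invariant (from i) R-inv
        #R≡k+#R′ : k + # R′? ≡ suc m
        #R≡k+#R′ = trans (sym (#-without-orbit R? R-inv Ry)) #R≡1+m
        #R′<#R : # R′? < suc m
        #R′<#R = subst (# R′? <_) #R≡k+#R′ (m<n+m (# R′?) z<s)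

  x^|G|≡ε : ∀ x → x ^ order ≡ ε
  x^|G|≡ε x with ∃-period x
  ... | d , x^1+d≡ε with ∃-least {n = d} {P = λ j → x ^ suc j ≡ ε} (λ j → x ^ suc j ≟ ε) x^1+d≡ε
  ...   | k₀ , x^k≡ε , minimal with Period.period-∣-# x k₀ x^k≡ε minimal U? (λ _ → mk⇔ id id)
  ...     | divides q #G≡q*k =
    trans (cong (x ^_) (trans (sym (count-U {order})) #G≡q*k)) (^-*-ε q x^k≡ε)

Homomorphic : (G H : FinGroup) → (FinGroup.Carrier G → FinGroup.Carrier H) → Set
Homomorphic G H f = ∀ x y → f (FinGroup._∙_ G x y) ≡ FinGroup._∙_ H (f x) (f y)

module Homomorphism (G H : FinGroup) (f : FinGroup.Carrier G → FinGroup.Carrier H)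
                    (homo : Homomorphic G H f) where
  open FinGroup G using () renaming (_∙_ to _∙₁_; ε to ε₁; _⁻¹ to _⁻¹₁)
  open FinGroup H using (_∙_; ε; _⁻¹)
  open FinGroupProperties G using () renaming (_^_ to _^₁_; _//_ to _//₁_)
  open FinGroupProperties H

  ε-homo : f ε₁ ≡ ε
  ε-homo = identityˡ-unique (f ε₁) (f ε₁) (trans (sym (homo ε₁ ε₁)) (cong f (FinGroup.identityˡ G ε₁)))

  ⁻¹-homo : ∀ x → f (x ⁻¹₁) ≡ f x ⁻¹
  ⁻¹-homo x = inverseʳ-unique (f x) (f (x ⁻¹₁))
                (trans (sym (homo x (x ⁻¹₁))) (trans (cong f (FinGroup.inverseʳ G x)) ε-homo))

  //-homo : ∀ x y → f (x //₁ y) ≡ f x // f y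
  //-homo x y = trans (homo x (y ⁻¹₁)) (cong (f x ∙_) (⁻¹-homo y))

  ^-homo : ∀ x m → f (x ^₁ m) ≡ f x ^ m
  ^-homo x zero    = ε-homo
  ^-homo x (suc m) = trans (homo x (x ^₁ m)) (cong (f x ∙_) (^-homo x m))

  coprime⇒trivial : gcd ∣ G ∣ ∣ H ∣ ≡ 1 → ∀ x → f x ≡ ε
  coprime⇒trivial gcd≡1 x = ^-coprime-ε {∣ G ∣} {∣ H ∣} (f x) gcd≡1
    (trans (sym (^-homo x ∣ G ∣)) (trans (cong f (Lagrange.x^|G|≡ε G x)) ε-homo))
    (Lagrange.x^|G|≡ε H (f x))

module Cayley (G : FinGroup) (S : Subset G) where
  open FinGroup G
  open FinGroupProperties G

  edge⇒//∈ : ∀ {x y} → Digraph.Edge (Cay G S) x y → _∈_ {G} (y // x) S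
  edge⇒//∈ {x} (s , s∈S , refl) = subst (λ u → _∈_ {G} u S) (sym (//-rightDividesʳ x s)) s∈S

  //∈⇒edge : ∀ {x y} → _∈_ {G} (y // x) S → Digraph.Edge (Cay G S) x y
  //∈⇒edge {x} {y} y//x∈S = y // x , y//x∈S , sym (//-rightDividesˡ x y)

  cayleyAut : (π : Carrier ↔ Carrier) →
              (∀ x y → S (Inverse.to π y // Inverse.to π x) ≡ S (y // x)) → DigraphAut (Cay G S)
  cayleyAut π π-// = record
    { perm     = π
    ; preserve = λ x y e → //∈⇒edge (trans (π-// x y) (edge⇒//∈ e))
    ; reflect  = λ x y e → //∈⇒edge (trans (sym (π-// x y)) (edge⇒//∈ e))
    }

  idᴰ : DigraphAut (Cay G S)
  idᴰ = cayleyAut ↔-refl λ _ _ → refl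

  DRR⇒AutGS-trivial : IsDRR G S → AutGS-trivial G S
  DRR⇒AutGS-trivial (_ , unique) φ φ[S]≡S = unique φᴰ idᴰ ε ε-homo
    where
    open GroupAut φ
    open Homomorphism G G (Inverse.to bij) homo
    φᴰ : DigraphAut (Cay G S)
    φᴰ = cayleyAut bij λ x y → trans (cong S (sym (//-homo y x))) (φ[S]≡S (y // x))

module ProductAutomorphism (G₁ G₂ : FinGroup) (φ : GroupAut (G₁ ×G G₂))
                          (gcd≡1 : gcd ∣ G₁ ∣ ∣ G₂ ∣ ≡ 1) where
  open FinGroup G₁ using () renaming (Carrier to C₁; _∙_ to _∙₁_; ε to ε₁; identityʳ to identityʳ₁)
  open FinGroup G₂ using () renaming (Carrier to C₂; _∙_ to _∙₂_; ε to ε₂; identityˡ to identityˡ₂)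
  open Inverse (GroupAut.bij φ) using (to; from; strictlyInverseˡ; strictlyInverseʳ)
  open GroupAut φ using (homo)
  open ≡-Reasoning

  α : C₁ → C₁
  α a = proj₁ (to (a , ε₂))

  β : C₁ → C₂
  β a = proj₂ (to (a , ε₂))

  γ : C₂ → C₁
  γ b = proj₁ (to (ε₁ , b))

  δ : C₂ → C₂
  δ b = proj₂ (to (ε₁ , b))

  to-inj₁-homo : ∀ a a′ → to (a ∙₁ a′ , ε₂) ≡ (α a ∙₁ α a′ , β a ∙₂ β a′)
  to-inj₁-homo a a′ =
    trans (cong (λ e → to (a ∙₁ a′ , e)) (sym (identityˡ₂ ε₂))) (homo (a , ε₂) (a′ , ε₂))

  to-inj₂-homo : ∀ b b′ → to (ε₁ , b ∙₂ b′) ≡ (γ b ∙₁ γ b′ , δ b ∙₂ δ b′)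
  to-inj₂-homo b b′ =
    trans (cong (λ e → to (e , b ∙₂ b′)) (sym (identityʳ₁ ε₁))) (homo (ε₁ , b) (ε₁ , b′))

  α-homo : Homomorphic G₁ G₁ α
  α-homo a a′ = cong proj₁ (to-inj₁-homo a a′)

  β-homo : Homomorphic G₁ G₂ β
  β-homo a a′ = cong proj₂ (to-inj₁-homo a a′)

  γ-homo : Homomorphic G₂ G₁ γ
  γ-homo b b′ = cong proj₁ (to-inj₂-homo b b′)

  δ-homo : Homomorphic G₂ G₂ δ
  δ-homo b b′ = cong proj₂ (to-inj₂-homo b b′)

  α-ε : α ε₁ ≡ ε₁
  α-ε = Homomorphism.ε-homo G₁ G₁ α α-homo

  δ-ε : δ ε₂ ≡ ε₂
  δ-ε = Homomorphism.ε-homo G₂ G₂ δ δ-homo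

  β-trivial : ∀ a → β a ≡ ε₂
  β-trivial = Homomorphism.coprime⇒trivial G₁ G₂ β β-homo gcd≡1

  γ-trivial : ∀ b → γ b ≡ ε₁
  γ-trivial = Homomorphism.coprime⇒trivial G₂ G₁ γ γ-homo (trans (gcd-comm ∣ G₂ ∣ ∣ G₁ ∣) gcd≡1)

  to-diagonal : ∀ a b → to (a , b) ≡ (α a , δ b)
  to-diagonal a b = begin
    to (a , b)                  ≡⟨ cong to (cong₂ _,_ (identityʳ₁ a) (identityˡ₂ b)) ⟨
    to (a ∙₁ ε₁ , ε₂ ∙₂ b)      ≡⟨ homo (a , ε₂) (ε₁ , b) ⟩
    (α a ∙₁ γ b , β a ∙₂ δ b)   ≡⟨ cong₂ _,_ (cong (α a ∙₁_) (γ-trivial b)) (cong (_∙₂ δ b) (β-trivial a)) ⟩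
    (α a ∙₁ ε₁ , ε₂ ∙₂ δ b)     ≡⟨ cong₂ _,_ (identityʳ₁ (α a)) (identityˡ₂ (δ b)) ⟩
    (α a , δ b)                 ∎

  diagonal-from : ∀ u → (α (proj₁ (from u)) , δ (proj₂ (from u))) ≡ u
  diagonal-from u = trans (sym (to-diagonal _ _)) (strictlyInverseˡ u)

  from-diagonal : ∀ a b → from (α a , δ b) ≡ (a , b)
  from-diagonal a b = trans (cong from (sym (to-diagonal a b))) (strictlyInverseʳ (a , b))

  α-aut : GroupAut G₁
  α-aut = record
    { bij  = mk↔ₛ′ α (λ a → proj₁ (from (a , ε₂)))
                   (λ a → cong proj₁ (diagonal-from (a , ε₂)))
                   (λ a → cong proj₁ (trans (cong (λ e → from (α a , e)) (sym δ-ε)) (from-diagonal a ε₂)))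
    ; homo = α-homo
    }

  δ-aut : GroupAut G₂
  δ-aut = record
    { bij  = mk↔ₛ′ δ (λ b → proj₂ (from (ε₁ , b)))
                   (λ b → cong proj₂ (diagonal-from (ε₁ , b)))
                   (λ b → cong proj₂ (trans (cong (λ e → from (e , δ b)) (sym α-ε)) (from-diagonal ε₁ b)))
    ; homo = δ-homo
    }

module ConnectionSet (G₁ G₂ : FinGroup) (S₁ : Subset G₁) (S₂ : Subset G₂) where
  open FinGroup G₁ using () renaming (Carrier to C₁; ε to ε₁; _⁻¹ to _⁻¹₁)
  open FinGroup G₂ using () renaming (Carrier to C₂; ε to ε₂; _∙_ to _∙₂_; _⁻¹ to _⁻¹₂)
  open FinGroup G₂ using () renaming (identityˡ to identityˡ₂)
  open FinGroupProperties G₁ using (x∙y⁻¹≈ε⇒x≈y; ε⁻¹≈ε; ⁻¹-involutive)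
    renaming (_≟_ to _≟₁_; _//_ to _//₁_)
  open FinGroupProperties G₂ using (x∙z//y∙z≡x//y; //-rightDividesˡ; //-rightDividesʳ)
    renaming (_//_ to _//₂_)
  open FinGroupProperties (G₁ ×G G₂) using (_//_)
  open ≡-Reasoning

  S : Subset (G₁ ×G G₂)
  S (a , b) = if does (a ≟₁ ε₁) then S₂ b else S₁ a

  S-ε : ∀ b → S (ε₁ , b) ≡ S₂ b
  S-ε b = cong (if_then S₂ b else S₁ ε₁) (dec-true (ε₁ ≟₁ ε₁) refl)

  S-≢ε : ∀ {a} b → a ≢ ε₁ → S (a , b) ≡ S₁ a
  S-≢ε {a} b a≢ε = cong (if_then S₂ b else S₁ a) (dec-false (a ≟₁ ε₁) a≢ε)

  S-inverseClosed : InverseClosed G₁ S₁ → InverseClosed G₂ S₂ → InverseClosed (G₁ ×G G₂) S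
  S-inverseClosed S₁⁻¹ S₂⁻¹ (a , b) ab∈S with a ≟₁ ε₁
  ... | yes refl = begin
    S (ε₁ ⁻¹₁ , b ⁻¹₂)   ≡⟨ cong (λ e → S (e , b ⁻¹₂)) ε⁻¹≈ε ⟩
    S (ε₁ , b ⁻¹₂)       ≡⟨ S-ε (b ⁻¹₂) ⟩
    S₂ (b ⁻¹₂)           ≡⟨ S₂⁻¹ b (trans (sym (S-ε b)) ab∈S) ⟩
    true                 ∎
  ... | no a≢ε = trans (S-≢ε (b ⁻¹₂) a⁻¹≢ε) (S₁⁻¹ a (trans (sym (S-≢ε b a≢ε)) ab∈S))
    where
    a⁻¹≢ε : a ⁻¹₁ ≢ ε₁
    a⁻¹≢ε a⁻¹≡ε = a≢ε (trans (sym (⁻¹-involutive a)) (trans (cong _⁻¹₁ a⁻¹≡ε) ε⁻¹≈ε))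

  S-rigid : gcd ∣ G₁ ∣ ∣ G₂ ∣ ≡ 1 → IsDRR G₁ S₁ → IsDRR G₂ S₂ → AutGS-trivial (G₁ ×G G₂) S
  S-rigid gcd≡1 drr₁ drr₂ φ φ[S]≡S (a , b) = begin
    to (a , b)    ≡⟨ to-diagonal a b ⟩
    (α a , δ b)   ≡⟨ cong₂ _,_ (Cayley.DRR⇒AutGS-trivial G₁ S₁ drr₁ α-aut α[S₁]≡S₁ a)
                               (Cayley.DRR⇒AutGS-trivial G₂ S₂ drr₂ δ-aut δ[S₂]≡S₂ b) ⟩
    (a , b)       ∎
    where
    open ProductAutomorphism G₁ G₂ φ gcd≡1
    open Inverse (GroupAut.bij φ) using (to)
    α[S₁]≡S₁ : Fixes α-aut S₁
    α[S₁]≡S₁ s with s ≟₁ ε₁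
    ... | yes refl = cong S₁ α-ε
    ... | no s≢ε = begin
      S₁ (α s)           ≡⟨ S-≢ε (δ ε₂) αs≢ε ⟨
      S (α s , δ ε₂)     ≡⟨ cong S (to-diagonal s ε₂) ⟨
      S (to (s , ε₂))    ≡⟨ φ[S]≡S (s , ε₂) ⟩
      S (s , ε₂)         ≡⟨ S-≢ε ε₂ s≢ε ⟩
      S₁ s               ∎
      where
      αs≢ε : α s ≢ ε₁
      αs≢ε αs≡ε = s≢ε (Injection.injective (↔⇒↣ (GroupAut.bij α-aut)) (trans αs≡ε (sym α-ε)))
    δ[S₂]≡S₂ : Fixes δ-aut S₂
    δ[S₂]≡S₂ t = begin
      S₂ (δ t)           ≡⟨ S-ε (δ t) ⟨
      S (ε₁ , δ t)       ≡⟨ cong (λ e → S (e , δ t)) α-ε ⟨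
      S (α ε₁ , δ t)     ≡⟨ cong S (to-diagonal ε₁ t) ⟨
      S (to (ε₁ , t))    ≡⟨ φ[S]≡S (ε₁ , t) ⟩
      S (ε₁ , t)         ≡⟨ S-ε t ⟩
      S₂ t               ∎

  -- An edge leaving the fibre {a} × G₂ reaches every vertex of the fibre it enters, so
  -- right translation inside the single fibre {ε₁} × G₂ preserves and reflects all edges.
  module FibreShift (h : C₂) where
    shift : C₁ → C₂
    shift a = if does (a ≟₁ ε₁) then h else ε₂

    shift-ε : shift ε₁ ≡ h
    shift-ε = cong (if_then h else ε₂) (dec-true (ε₁ ≟₁ ε₁) refl)

    shift-≢ε : ∀ {a} → a ≢ ε₁ → shift a ≡ ε₂
    shift-≢ε {a} a≢ε = cong (if_then h else ε₂) (dec-false (a ≟₁ ε₁) a≢ε)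

    ψ : (C₁ × C₂) ↔ (C₁ × C₂)
    ψ = mk↔ₛ′ (λ (a , b) → a , b ∙₂ shift a) (λ (a , b) → a , b //₂ shift a)
              (λ (a , b) → cong (a ,_) (//-rightDividesˡ (shift a) b))
              (λ (a , b) → cong (a ,_) (//-rightDividesʳ (shift a) b))

    ψ-// : ∀ x y → S (Inverse.to ψ y // Inverse.to ψ x) ≡ S (y // x)
    ψ-// (a , b) (c , d) with c ≟₁ a
    ... | yes refl = cong (λ e → S (c //₁ c , e)) (x∙z//y∙z≡x//y d b (shift c))
    ... | no c≢a   = trans (S-≢ε _ c//a≢ε) (sym (S-≢ε _ c//a≢ε))
      where
      c//a≢ε : c //₁ a ≢ ε₁
      c//a≢ε = c≢a ∘ x∙y⁻¹≈ε⇒x≈y c a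

    ψᴰ : DigraphAut (Cay (G₁ ×G G₂) S)
    ψᴰ = Cayley.cayleyAut (G₁ ×G G₂) S ψ ψ-//

  S-not-DRR : Nontrivial G₁ → Nontrivial G₂ → ¬ IsDRR (G₁ ×G G₂) S
  S-not-DRR (g , g≢ε) (h , h≢ε) (_ , unique) = h≢ε (begin
    h                 ≡⟨ identityˡ₂ h ⟨
    ε₂ ∙₂ h           ≡⟨ cong (ε₂ ∙₂_) shift-ε ⟨
    ε₂ ∙₂ shift ε₁    ≡⟨ cong proj₂ (unique ψᴰ (Cayley.idᴰ (G₁ ×G G₂) S) (g , ε₂) ψ-fixes-g (ε₁ , ε₂)) ⟩
    ε₂                ∎)
    where
    open FibreShift h
    ψ-fixes-g : (g , ε₂ ∙₂ shift g) ≡ (g , ε₂)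
    ψ-fixes-g = cong (g ,_) (trans (cong (ε₂ ∙₂_) (shift-≢ε g≢ε)) (identityˡ₂ ε₂))

theorem1p8 :
    (∀ (G₁ G₂ : FinGroup) → Nontrivial G₁ → Nontrivial G₂ →
      AdmitsDRR G₁ → AdmitsDRR G₂ → gcd ∣ G₁ ∣ ∣ G₂ ∣ ≡ 1 →
      ¬ DRR-detecting (G₁ ×G G₂))
    ×
    (∀ (G₁ G₂ : FinGroup) → Nontrivial G₁ → Nontrivial G₂ →
      AdmitsGRR G₁ → AdmitsGRR G₂ → gcd ∣ G₁ ∣ ∣ G₂ ∣ ≡ 1 →
      ¬ GRR-detecting (G₁ ×G G₂))
theorem1p8 =
  (λ G₁ G₂ nt₁ nt₂ (S₁ , drr₁) (S₂ , drr₂) gcd≡1 detecting →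
    let open ConnectionSet G₁ G₂ S₁ S₂
    in S-not-DRR nt₁ nt₂ (detecting S (S-rigid gcd≡1 drr₁ drr₂))) ,
  (λ G₁ G₂ nt₁ nt₂ (S₁ , inv₁ , drr₁) (S₂ , inv₂ , drr₂) gcd≡1 detecting →
    let open ConnectionSet G₁ G₂ S₁ S₂
    in S-not-DRR nt₁ nt₂ (detecting S (S-inverseClosed inv₁ inv₂) (S-rigid gcd≡1 drr₁ drr₂)))
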